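{- Let $I$ be a composition of $n$ and let $\le_I$ be the order on subsets of $\{1,\dots,n\}$ defined below. For every $1\le i\le n-1$ and every $D\subseteq\{1,\dots,n\}$, $$T_i\,c_D\epsilon_I=\alpha(i,I,D)\,c_D\epsilon_I+\sum_{D'<_I D}\beta_{D'}\,c_{D'}\epsilon_I$$ for some scalars $\beta_{D'}$, with $\alpha(i,I,D)\in\{0,-1\}$; that is, the action of each $T_i$ on $M_I$ is triangular with respect to $\le_I$.
   Context: $HCl_n(0)$ is the unital $\mathbb{C}$-algebra generated by $T_1,\dots,T_{n-1}$, $c_1,\dots,c_n$ with relations $T_i^2=-T_i$; $T_iT_j=T_jT_i$ ($|i-j|>1$); $T_iT_{i+1}T_i=T_{i+1}T_iT_{i+1}$; $c_ic_j=-c_jc_i$ ($i\ne j$); $c_i^2=-1$; $T_ic_j=c_jT_i$ ($j\ne i,i+1$); $T_ic_i=c_{i+1}T_i$; $(T_i+1)c_{i+1}=c_i(T_i+1)$. $H_n(0)$ is the subalgebra generated by the $T_i$. For $D=\{d_1<\dots<d_k\}$, $c_D=c_{d_1}\cdots c_{d_k}$. For a composition $I=(i_1,\dots,i_r)$ of $n$, $\operatorname{Des}(I)=\{i_1,i_1+i_2,\dots,i_1+\dots+i_{r-1}\}$; $S_I=\mathbb{C}\epsilon_I$ is the $H_n(0)$-module with $T_j\epsilon_I=-\epsilon_I$ if $j\in\operatorname{Des}(I)$ and $0$ otherwise, and $M_I=HCl_n(0)\otimes_{H_n(0)}S_I$, which has basis $(c_D\epsilon_I)_{D\subseteq\{1,\dots,n\}}$.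 The order $\le_I$ is the reflexive–transitive closure of the following relations $D'<_I D$, for $1\le i\le n-1$: if $i\notin\operatorname{Des}(I)$: (a) $i\notin D$, $i+1\in D$, $D'=(D\setminus\{i+1\})\cup\{i\}$; (b) $i,i+1\in D$, $D'=D\setminus\{i,i+1\}$. If $i\in\operatorname{Des}(I)$: (c) $i\in D$, $i+1\notin D$, $D'=(D\setminus\{i\})\cup\{i+1\}$; (d) $i,i+1\in D$, $D'=D\setminus\{i,i+1\}$. (This closure is a partial order.) -}

module Defs where

open import Level using (Level; _⊔_) renaming (suc to lsuc)
open import Data.Nat using (ℕ; zero; suc; _+_; _≤_; _<_)
open import Data.Bool using (Bool; true; false; if_then_else_)
open import Data.List using (List; []; _∷_; map; foldr; _++_)
open import Data.Nat.ListAction using (sum)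
open import Data.List.Relation.Unary.All using (All)
open import Data.List.Membership.Propositional using (_∈_)
open import Data.Vec using (Vec; []; _∷_)
open import Data.Product using (Σ; _×_; _,_; proj₁; proj₂)
open import Relation.Nullary using (¬_)
open import Relation.Binary.PropositionalEquality using (_≡_; _≢_)
open import Relation.Binary.Construct.Closure.ReflexiveTransitive using (Star)
open import Algebra.Bundles using (CommutativeRing)
open import Algebra.Module.Bundles using (Module)

record Composition (n : ℕ) : Set where
  field
    parts    : List ℕ
    positive : All (λ a → 0 < a) parts
    total    : sum parts ≡ n
open Composition public

desList : List ℕ → List ℕ
desList []            = []
desList (a ∷ [])      = []
desList (a ∷ b ∷ bs)  = a ∷ map (a +_) (desList (b ∷ bs))

Des : ∀ {n} → Composition n → List ℕ
Des I = desList (parts I)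

-- Subsets of {1,…,n} as Vec Bool n; position k (0-based) ↔ element k+1.

Subset : ℕ → Set
Subset n = Vec Bool n

mem : ∀ {n} → Subset n → ℕ → Bool
mem []       _             = false
mem (b ∷ bs) zero          = false
mem (b ∷ bs) (suc zero)    = b
mem (b ∷ bs) (suc (suc k)) = mem bs (suc k)

setAt : ∀ {n} → Subset n → ℕ → Bool → Subset n
setAt []       _             v = []
setAt (b ∷ bs) zero          v = b ∷ bs
setAt (b ∷ bs) (suc zero)    v = v ∷ bs
setAt (b ∷ bs) (suc (suc k)) v = b ∷ setAt bs (suc k) v

allSubsets : ∀ n → List (Subset n)
allSubsets zero    = [] ∷ []
allSubsets (suc n) = map (false ∷_) (allSubsets n) ++ map (true ∷_) (allSubsets n)

data Step {n : ℕ} (I : Composition n) : Subset n → Subset n → Set where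
  stepA : ∀ i D → 1 ≤ i → suc i ≤ n → ¬ (i ∈ Des I) →
          mem D i ≡ false → mem D (suc i) ≡ true →
          Step I (setAt (setAt D (suc i) false) i true) D
  stepB : ∀ i D → 1 ≤ i → suc i ≤ n → ¬ (i ∈ Des I) →
          mem D i ≡ true → mem D (suc i) ≡ true →
          Step I (setAt (setAt D i false) (suc i) false) D
  stepC : ∀ i D → 1 ≤ i → suc i ≤ n → i ∈ Des I →
          mem D i ≡ true → mem D (suc i) ≡ false →
          Step I (setAt (setAt D i false) (suc i) true) D
  stepD : ∀ i D → 1 ≤ i → suc i ≤ n → i ∈ Des I →
          mem D i ≡ true → mem D (suc i) ≡ true →
          Step I (setAt (setAt D i false) (suc i) false) D

_≤[_]_ : ∀ {n} → Subset n → Composition n → Subset n → Set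
D' ≤[ I ] D = Star (Step I) D' D

_<[_]_ : ∀ {n} → Subset n → Composition n → Subset n → Set
D' <[ I ] D = (D' ≤[ I ] D) × (D' ≢ D)

-- HCl_n(0)-modules: a K-module M with K-linear operators T_i (1 ≤ i ≤ n-1)
-- and c_j (1 ≤ j ≤ n) satisfying the defining relations of HCl_n(0).

module _ {r ℓr m ℓm : Level} {K : CommutativeRing r ℓr} (M : Module K m ℓm) where
  open CommutativeRing K using () renaming (Carrier to R)
  open Module M

  record HClModule (n : ℕ) : Set (r ⊔ m ⊔ ℓm) where
    field
      T : ℕ → Carrierᴹ → Carrierᴹ
      c : ℕ → Carrierᴹ → Carrierᴹ
      T-cong : ∀ i {x y} → 1 ≤ i → suc i ≤ n → x ≈ᴹ y → T i x ≈ᴹ T i y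
      T-+    : ∀ i x y → 1 ≤ i → suc i ≤ n → T i (x +ᴹ y) ≈ᴹ T i x +ᴹ T i y
      T-*    : ∀ i (a : R) x → 1 ≤ i → suc i ≤ n → T i (a *ₗ x) ≈ᴹ a *ₗ T i x
      c-cong : ∀ j {x y} → 1 ≤ j → j ≤ n → x ≈ᴹ y → c j x ≈ᴹ c j y
      c-+    : ∀ j x y → 1 ≤ j → j ≤ n → c j (x +ᴹ y) ≈ᴹ c j x +ᴹ c j y
      c-*    : ∀ j (a : R) x → 1 ≤ j → j ≤ n → c j (a *ₗ x) ≈ᴹ a *ₗ c j x
      T-sq    : ∀ i x → 1 ≤ i → suc i ≤ n → T i (T i x) ≈ᴹ -ᴹ T i x
      -- T_i T_j = T_j T_i for |i-j| > 1 (stated for i+2 ≤ j; symmetric)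
      T-comm  : ∀ i j x → 1 ≤ i → suc (suc i) ≤ j → suc j ≤ n →
                T i (T j x) ≈ᴹ T j (T i x)
      T-braid : ∀ i x → 1 ≤ i → suc (suc i) ≤ n →
                T i (T (suc i) (T i x)) ≈ᴹ T (suc i) (T i (T (suc i) x))
      c-anti  : ∀ i j x → 1 ≤ i → i ≤ n → 1 ≤ j → j ≤ n → i ≢ j →
                c i (c j x) ≈ᴹ -ᴹ c j (c i x)
      c-sq    : ∀ i x → 1 ≤ i → i ≤ n → c i (c i x) ≈ᴹ -ᴹ x
      Tc-comm : ∀ i j x → 1 ≤ i → suc i ≤ n → 1 ≤ j → j ≤ n →
                j ≢ i → j ≢ suc i → T i (c j x) ≈ᴹ c j (T i x)
      Tc-i    : ∀ i x → 1 ≤ i → suc i ≤ n → T i (c i x) ≈ᴹ c (suc i) (T i x)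
      Tc-i+1  : ∀ i x → 1 ≤ i → suc i ≤ n →
                T i (c (suc i) x) +ᴹ c (suc i) x ≈ᴹ c i (T i x +ᴹ x)

  module _ {n : ℕ} (H : HClModule n) where
    open HClModule H

    applyC : ∀ {k} → ℕ → Subset k → Carrierᴹ → Carrierᴹ
    applyC j []           x = x
    applyC j (true  ∷ bs) x = c j (applyC (suc j) bs x)
    applyC j (false ∷ bs) x = applyC (suc j) bs x

    cD : Subset n → Carrierᴹ → Carrierᴹ
    cD D x = applyC 1 D x

    sumAll : (Subset n → R) → Carrierᴹ → Carrierᴹ
    sumAll a ε = foldr (λ D acc → (a D *ₗ cD D ε) +ᴹ acc) 0ᴹ (allSubsets n)

    sumList : List (R × Subset n) → Carrierᴹ → Carrierᴹ
    sumList L ε = foldr (λ p acc → (proj₁ p *ₗ cD (proj₂ p) ε) +ᴹ acc) 0ᴹ L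

    -- ε spans the one-dimensional H_n(0)-module S_I inside M:
    -- T_j ε = -ε if j ∈ Des(I), and T_j ε = 0 otherwise
    record IsGeneratorOfS (I : Composition n) (ε : Carrierᴹ) : Set (r ⊔ m ⊔ ℓm) where
      field
        T-des    : ∀ j → 1 ≤ j → suc j ≤ n → j ∈ Des I → T j ε ≈ᴹ -ᴹ ε
        T-nondes : ∀ j → 1 ≤ j → suc j ≤ n → ¬ (j ∈ Des I) → T j ε ≈ᴹ 0ᴹ

    record IsCBasis (ε : Carrierᴹ) : Set (r ⊔ ℓr ⊔ m ⊔ ℓm) where
      open CommutativeRing K using (_≈_; 0#)
      field
        spanning    : ∀ x → Σ (Subset n → R) λ a → x ≈ᴹ sumAll a ε
        independent : ∀ (a : Subset n → R) → sumAll a ε ≈ᴹ 0ᴹ → ∀ D → a D ≈ 0#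

-- Write c_D ε = c_{D ∩ [1,i-1]} c_i^a c_{i+1}^b y with y = c_{D ∩ [i+2,n]} ε. The factors c_j with
-- j < i and j > i+1 commute with T_i, so T_i y = -y or 0 according as i is a descent of I,
-- and the relations T_i c_i = c_{i+1} T_i and (T_i + 1) c_{i+1} = c_i (T_i + 1) compute
-- T_i on c_i^a c_{i+1}^b y in each of the four cases (a, b): the result is 0 or -1 times
-- the vector itself plus at most one term c_{D'} ε, where D' is obtained from D by one of
-- the covering moves (a)-(d) defining <_I.

module Submission where

open import Defs
open import Level using (Level; _⊔_)
open import Function using (_∘_)
open import Data.Nat using (ℕ; suc; zero; _+_; _≤_; _<_; z≤n; s≤s; s≤s⁻¹)
open import Data.Nat.Properties
  using (_≟_; +-suc; +-comm; ≤-refl; ≤-trans; <⇒≤; <⇒≢; >⇒≢; m<n⇒m<1+n; m≤n+m; m+n≤o⇒m≤o)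
open import Data.Bool using (true; false; not)
open import Data.Bool.Properties using (not-¬)
open import Data.Vec using ([]; _∷_)
open import Data.List using (List; []; _∷_; foldr; map)
open import Data.List.Properties using (foldr-map)
open import Data.List.Relation.Unary.All as All using (All; []; _∷_)
open import Data.List.Relation.Unary.All.Properties using (map⁺)
open import Data.List.Membership.Propositional using (_∈_)
open import Data.List.Membership.DecPropositional _≟_ using (_∈?_)
open import Data.Product using (Σ; _×_; _,_; proj₁; proj₂; map₂)
open import Data.Sum using (_⊎_; inj₁; inj₂)
open import Relation.Nullary using (¬_; yes; no)
open import Relation.Binary.PropositionalEquality as ≡ using (_≡_; _≢_)
open import Relation.Binary.Construct.Closure.ReflexiveTransitive using (_◅_) renaming (ε to ◅-end)
open import Algebra.Bundles using (CommutativeRing)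
open import Algebra.Module.Bundles using (Module)
import Algebra.Definitions as AlgebraDefinitions
import Algebra.Module.Morphism.Definitions as MorphismDefinitions
import Algebra.Properties.AbelianGroup as AbelianGroupProperties
import Relation.Binary.Reasoning.Setoid as SetoidReasoning

m+[1+k]≤n⇒1+m+k≤n : ∀ {m k n} → m + suc k ≤ n → suc m + k ≤ n
m+[1+k]≤n⇒1+m+k≤n {m} {k} {n} = ≡.subst (_≤ n) (+-suc m k)

m+[1+k]≤1+n⇒m≤n : ∀ {m k n} → m + suc k ≤ suc n → m ≤ n
m+[1+k]≤1+n⇒m≤n {m} = s≤s⁻¹ ∘ m+n≤o⇒m≤o (suc m) ∘ m+[1+k]≤n⇒1+m+k≤n

mem-setAt : ∀ {k} (D : Subset k) j v → 1 ≤ j → j ≤ k → mem (setAt D j v) j ≡ v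
mem-setAt (b ∷ D) (suc zero)    v _ _         = ≡.refl
mem-setAt (b ∷ D) (suc (suc j)) v _ (s≤s j≤k) = mem-setAt D (suc j) v (s≤s z≤n) j≤k

setAt-≢ : ∀ {k} (D E : Subset k) j v → 1 ≤ j → j ≤ k → mem D j ≡ not v → setAt E j v ≢ D
setAt-≢ D E j v 1≤j j≤k Dj≡¬v E′≡D =
  not-¬ (≡.trans (≡.cong (λ X → mem X j) (≡.sym E′≡D)) (mem-setAt E j v 1≤j j≤k)) Dj≡¬v

-- The moves (a)-(d) at position p, with P standing for p ∈ Des(I). Unlike Step it is not
-- tied to a composition of the length k, so it is stable under prepending entries.
data StepAt {k : ℕ} (P : Set) (p : ℕ) (D : Subset k) : Subset k → Set where
  stepA : ¬ P → mem D p ≡ false → mem D (suc p) ≡ true →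
          StepAt P p D (setAt (setAt D (suc p) false) p true)
  stepB : ¬ P → mem D p ≡ true → mem D (suc p) ≡ true →
          StepAt P p D (setAt (setAt D p false) (suc p) false)
  stepC : P → mem D p ≡ true → mem D (suc p) ≡ false →
          StepAt P p D (setAt (setAt D p false) (suc p) true)
  stepD : P → mem D p ≡ true → mem D (suc p) ≡ true →
          StepAt P p D (setAt (setAt D p false) (suc p) false)

StepAt-∷ : ∀ {k P p} b {D D′ : Subset k} → StepAt P (suc p) D D′ → StepAt P (suc (suc p)) (b ∷ D) (b ∷ D′)
StepAt-∷ b (stepA ¬P Dp Dp+1) = stepA ¬P Dp Dp+1
StepAt-∷ b (stepB ¬P Dp Dp+1) = stepB ¬P Dp Dp+1
StepAt-∷ b (stepC P  Dp Dp+1) = stepC P  Dp Dp+1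
StepAt-∷ b (stepD P  Dp Dp+1) = stepD P  Dp Dp+1

StepAt⇒< : ∀ {n} (I : Composition n) i {D D′ : Subset n} → 1 ≤ i → suc i ≤ n →
           StepAt (i ∈ Des I) i D D′ → D′ <[ I ] D
StepAt⇒< I i {D} 1≤i i<n (stepA ¬P Di Di+1) =
  stepA i D 1≤i i<n ¬P Di Di+1 ◅ ◅-end , setAt-≢ D _ i true 1≤i (<⇒≤ i<n) Di
StepAt⇒< I i {D} 1≤i i<n (stepB ¬P Di Di+1) =
  stepB i D 1≤i i<n ¬P Di Di+1 ◅ ◅-end , setAt-≢ D _ (suc i) false (s≤s z≤n) i<n Di+1
StepAt⇒< I i {D} 1≤i i<n (stepC P Di Di+1) =
  stepC i D 1≤i i<n P Di Di+1 ◅ ◅-end , setAt-≢ D _ (suc i) true (s≤s z≤n) i<n Di+1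
StepAt⇒< I i {D} 1≤i i<n (stepD P Di Di+1) =
  stepD i D 1≤i i<n P Di Di+1 ◅ ◅-end , setAt-≢ D _ (suc i) false (s≤s z≤n) i<n Di+1

module ModuleFacts {r ℓr m ℓm : Level} {K : CommutativeRing r ℓr} (M : Module K m ℓm) where
  open CommutativeRing K using (0#; 1#; -_; -‿inverseˡ) renaming (Carrier to R; _+_ to _+ʳ_)
  open Module M
  open AlgebraDefinitions _≈ᴹ_ using (Congruent₁)
  open MorphismDefinitions R Carrierᴹ Carrierᴹ _≈ᴹ_ using (Homomorphicₗ; Homomorphic₂)
  open AbelianGroupProperties +ᴹ-abelianGroup using (inverseˡ-unique)
  open SetoidReasoning ≈ᴹ-setoid

  linComb : ∀ {a} {A : Set a} → (A → Carrierᴹ) → List (R × A) → Carrierᴹ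
  linComb g = foldr (λ q acc → proj₁ q *ₗ g (proj₂ q) +ᴹ acc) 0ᴹ

  linComb-map₂ : ∀ {a b} {A : Set a} {B : Set b} (g : B → Carrierᴹ) (h : A → B) L →
                 linComb g (map (map₂ h) L) ≡ linComb (g ∘ h) L
  linComb-map₂ g h L = foldr-map _ (map₂ h) 0ᴹ L

  -1*x≈-x : ∀ x → (- 1#) *ₗ x ≈ᴹ -ᴹ x
  -1*x≈-x x = inverseˡ-unique _ _ (begin
    (- 1#) *ₗ x +ᴹ x       ≈⟨ +ᴹ-congˡ (*ₗ-identityˡ x) ⟨
    (- 1#) *ₗ x +ᴹ 1# *ₗ x ≈⟨ *ₗ-distribʳ x (- 1#) 1# ⟨
    ((- 1#) +ʳ 1#) *ₗ x    ≈⟨ *ₗ-congʳ (-‿inverseˡ 1#) ⟩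
    0# *ₗ x                ≈⟨ *ₗ-zeroˡ x ⟩
    0ᴹ                     ∎)

  module _ {f : Carrierᴹ → Carrierᴹ} (f-cong : Congruent₁ f) (f-*ₗ : Homomorphicₗ f _*ₗ_ _*ₗ_) where

    *ₗ-homo⇒0ᴹ-homo : f 0ᴹ ≈ᴹ 0ᴹ
    *ₗ-homo⇒0ᴹ-homo = begin
      f 0ᴹ          ≈⟨ f-cong (*ₗ-zeroˡ 0ᴹ) ⟨
      f (0# *ₗ 0ᴹ)  ≈⟨ f-*ₗ 0# 0ᴹ ⟩
      0# *ₗ f 0ᴹ    ≈⟨ *ₗ-zeroˡ (f 0ᴹ) ⟩
      0ᴹ            ∎

    *ₗ-homo⇒-ᴹ-homo : ∀ x → f (-ᴹ x) ≈ᴹ -ᴹ f x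
    *ₗ-homo⇒-ᴹ-homo x = begin
      f (-ᴹ x)          ≈⟨ f-cong (-1*x≈-x x) ⟨
      f ((- 1#) *ₗ x)   ≈⟨ f-*ₗ (- 1#) x ⟩
      (- 1#) *ₗ f x     ≈⟨ -1*x≈-x (f x) ⟩
      -ᴹ f x            ∎

    linComb-homo : Homomorphic₂ f _+ᴹ_ _+ᴹ_ → ∀ {a} {A : Set a} (g : A → Carrierᴹ) L →
                   f (linComb g L) ≈ᴹ linComb (f ∘ g) L
    linComb-homo f-+ g []      = *ₗ-homo⇒0ᴹ-homo
    linComb-homo f-+ g (q ∷ L) = ≈ᴹ-trans (f-+ _ _) (+ᴹ-cong (f-*ₗ _ _) (linComb-homo f-+ g L))

  -- Right-hand sides of the form α *ₗ x +ᴹ linComb g L, with L of length at most one.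

  -x≈-1*x+0 : ∀ x → -ᴹ x ≈ᴹ (- 1#) *ₗ x +ᴹ 0ᴹ
  -x≈-1*x+0 x = ≈ᴹ-trans (≈ᴹ-sym (-1*x≈-x x)) (≈ᴹ-sym (+ᴹ-identityʳ _))

  0≈0*x+0 : ∀ x → 0ᴹ ≈ᴹ 0# *ₗ x +ᴹ 0ᴹ
  0≈0*x+0 x = ≈ᴹ-sym (≈ᴹ-trans (+ᴹ-identityʳ _) (*ₗ-zeroˡ x))

  a*z≈0*x+[a*z+0] : ∀ a x z → a *ₗ z ≈ᴹ 0# *ₗ x +ᴹ (a *ₗ z +ᴹ 0ᴹ)
  a*z≈0*x+[a*z+0] a x z = begin
    a *ₗ z                     ≈⟨ +ᴹ-identityʳ _ ⟨
    a *ₗ z +ᴹ 0ᴹ               ≈⟨ +ᴹ-identityˡ _ ⟨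
    0ᴹ +ᴹ (a *ₗ z +ᴹ 0ᴹ)       ≈⟨ +ᴹ-congʳ (*ₗ-zeroˡ x) ⟨
    0# *ₗ x +ᴹ (a *ₗ z +ᴹ 0ᴹ)  ∎

  -z≈0*x+[-1*z+0] : ∀ x z → -ᴹ z ≈ᴹ 0# *ₗ x +ᴹ ((- 1#) *ₗ z +ᴹ 0ᴹ)
  -z≈0*x+[-1*z+0] x z = ≈ᴹ-trans (≈ᴹ-sym (-1*x≈-x z)) (a*z≈0*x+[a*z+0] (- 1#) x z)

  z≈0*x+[1*z+0] : ∀ x z → z ≈ᴹ 0# *ₗ x +ᴹ (1# *ₗ z +ᴹ 0ᴹ)
  z≈0*x+[1*z+0] x z = ≈ᴹ-trans (≈ᴹ-sym (*ₗ-identityˡ z)) (a*z≈0*x+[a*z+0] 1# x z)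

  -x+z≈-1*x+[1*z+0] : ∀ x z → -ᴹ x +ᴹ z ≈ᴹ (- 1#) *ₗ x +ᴹ (1# *ₗ z +ᴹ 0ᴹ)
  -x+z≈-1*x+[1*z+0] x z =
    +ᴹ-cong (≈ᴹ-sym (-1*x≈-x x)) (≈ᴹ-sym (≈ᴹ-trans (+ᴹ-identityʳ _) (*ₗ-identityˡ z)))

module HClFacts {r ℓr m ℓm : Level} {K : CommutativeRing r ℓr} {M : Module K m ℓm} {n : ℕ}
                (H : HClModule M n) where
  open CommutativeRing K using (_≈_; 0#; 1#; -_) renaming (Carrier to R; refl to ≈-refl)
  open Module M
  open HClModule H
  open ModuleFacts M
  open AlgebraDefinitions _≈ᴹ_ using (Congruent₁)
  open MorphismDefinitions R Carrierᴹ Carrierᴹ _≈ᴹ_ using (Homomorphicₗ)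
  open AbelianGroupProperties +ᴹ-abelianGroup using (x≈z//y; ⁻¹-involutive)
  open SetoidReasoning ≈ᴹ-setoid

  -- cs j D x is c_{D'} x for D' = {j - 1 + d | d ∈ D}: the entries of D index j, j+1, ….
  cs : ∀ {k} → ℕ → Subset k → Carrierᴹ → Carrierᴹ
  cs = applyC M H

  c-0ᴹ : ∀ {j} → 1 ≤ j → j ≤ n → c j 0ᴹ ≈ᴹ 0ᴹ
  c-0ᴹ {j} 1≤j j≤n = *ₗ-homo⇒0ᴹ-homo (c-cong j 1≤j j≤n) (λ a x → c-* j a x 1≤j j≤n)

  c--ᴹ : ∀ {j} → 1 ≤ j → j ≤ n → ∀ x → c j (-ᴹ x) ≈ᴹ -ᴹ c j x
  c--ᴹ {j} 1≤j j≤n = *ₗ-homo⇒-ᴹ-homo (c-cong j 1≤j j≤n) (λ a x → c-* j a x 1≤j j≤n)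

  cs-cong : ∀ {k} j (D : Subset k) → 1 ≤ j → j + k ≤ suc n → Congruent₁ (cs j D)
  cs-cong j []          1≤j fits x≈y = x≈y
  cs-cong j (true ∷ D)  1≤j fits x≈y =
    c-cong j 1≤j (m+[1+k]≤1+n⇒m≤n fits) (cs-cong (suc j) D (s≤s z≤n) (m+[1+k]≤n⇒1+m+k≤n fits) x≈y)
  cs-cong j (false ∷ D) 1≤j fits x≈y = cs-cong (suc j) D (s≤s z≤n) (m+[1+k]≤n⇒1+m+k≤n fits) x≈y

  cs-*ₗ : ∀ {k} j (D : Subset k) → 1 ≤ j → j + k ≤ suc n → Homomorphicₗ (cs j D) _*ₗ_ _*ₗ_
  cs-*ₗ j []          1≤j fits a x = ≈ᴹ-refl
  cs-*ₗ j (true ∷ D)  1≤j fits a x = ≈ᴹ-trans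
    (c-cong j 1≤j (m+[1+k]≤1+n⇒m≤n fits) (cs-*ₗ (suc j) D (s≤s z≤n) (m+[1+k]≤n⇒1+m+k≤n fits) a x))
    (c-* j a _ 1≤j (m+[1+k]≤1+n⇒m≤n fits))
  cs-*ₗ j (false ∷ D) 1≤j fits a x = cs-*ₗ (suc j) D (s≤s z≤n) (m+[1+k]≤n⇒1+m+k≤n fits) a x

  cs-0ᴹ : ∀ {k} j (D : Subset k) → 1 ≤ j → j + k ≤ suc n → cs j D 0ᴹ ≈ᴹ 0ᴹ
  cs-0ᴹ j D 1≤j fits = *ₗ-homo⇒0ᴹ-homo (cs-cong j D 1≤j fits) (cs-*ₗ j D 1≤j fits)

  cs--ᴹ : ∀ {k} j (D : Subset k) → 1 ≤ j → j + k ≤ suc n → ∀ x → cs j D (-ᴹ x) ≈ᴹ -ᴹ cs j D x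
  cs--ᴹ j D 1≤j fits = *ₗ-homo⇒-ᴹ-homo (cs-cong j D 1≤j fits) (cs-*ₗ j D 1≤j fits)

  c-linComb : ∀ {j} → 1 ≤ j → j ≤ n → ∀ {a} {A : Set a} (g : A → Carrierᴹ) L →
              c j (linComb g L) ≈ᴹ linComb (c j ∘ g) L
  c-linComb {j} 1≤j j≤n =
    linComb-homo (c-cong j 1≤j j≤n) (λ a x → c-* j a x 1≤j j≤n) (λ x y → c-+ j x y 1≤j j≤n)

  module AtIndex (i : ℕ) (1≤i : 1 ≤ i) (i<n : suc i ≤ n) where

    i≤n : i ≤ n
    i≤n = <⇒≤ i<n

    T-c-comm-< : ∀ {j} → 1 ≤ j → j < i → ∀ x → T i (c j x) ≈ᴹ c j (T i x)
    T-c-comm-< {j} 1≤j j<i x =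
      Tc-comm i j x 1≤i i<n 1≤j (≤-trans (<⇒≤ j<i) i≤n) (<⇒≢ j<i) (<⇒≢ (m<n⇒m<1+n j<i))

    T-c-comm-> : ∀ {j} → suc i < j → j ≤ n → ∀ x → T i (c j x) ≈ᴹ c j (T i x)
    T-c-comm-> {j} i+1<j j≤n x =
      Tc-comm i j x 1≤i i<n (≤-trans (s≤s z≤n) (<⇒≤ i+1<j)) j≤n (>⇒≢ (<⇒≤ i+1<j)) (>⇒≢ i+1<j)

    cs-T-comm : ∀ {k} j (D : Subset k) → j + k ≤ suc n → suc i < j → ∀ x →
                T i (cs j D x) ≈ᴹ cs j D (T i x)
    cs-T-comm j []          fits i+1<j x = ≈ᴹ-refl
    cs-T-comm j (true ∷ D)  fits i+1<j x = begin
      T i (c j (cs (suc j) D x))   ≈⟨ T-c-comm-> i+1<j (m+[1+k]≤1+n⇒m≤n fits) _ ⟩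
      c j (T i (cs (suc j) D x))   ≈⟨ c-cong j (≤-trans (s≤s z≤n) (<⇒≤ i+1<j)) (m+[1+k]≤1+n⇒m≤n fits)
                                        (cs-T-comm (suc j) D (m+[1+k]≤n⇒1+m+k≤n fits) (m<n⇒m<1+n i+1<j) x) ⟩
      c j (cs (suc j) D (T i x))   ∎
    cs-T-comm j (false ∷ D) fits i+1<j x =
      cs-T-comm (suc j) D (m+[1+k]≤n⇒1+m+k≤n fits) (m<n⇒m<1+n i+1<j) x

    T-cᵢ₊₁ : ∀ x → T i (c (suc i) x) ≈ᴹ c i (T i x +ᴹ x) +ᴹ -ᴹ c (suc i) x
    T-cᵢ₊₁ x = x≈z//y _ _ _ (Tc-i+1 i x 1≤i i<n)

    cᵢ₊₁[-cᵢ₊₁x]≈x : ∀ x → c (suc i) (-ᴹ c (suc i) x) ≈ᴹ x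
    cᵢ₊₁[-cᵢ₊₁x]≈x x = begin
      c (suc i) (-ᴹ c (suc i) x)   ≈⟨ c--ᴹ (s≤s z≤n) i<n _ ⟩
      -ᴹ c (suc i) (c (suc i) x)   ≈⟨ -ᴹ‿cong (c-sq (suc i) x (s≤s z≤n) i<n) ⟩
      -ᴹ -ᴹ x                      ≈⟨ ⁻¹-involutive x ⟩
      x                            ∎

    module _ {y : Carrierᴹ} (Ty≈-y : T i y ≈ᴹ -ᴹ y) where

      Tcᵢ-des : T i (c i y) ≈ᴹ -ᴹ c (suc i) y
      Tcᵢ-des = begin
        T i (c i y)          ≈⟨ Tc-i i y 1≤i i<n ⟩
        c (suc i) (T i y)    ≈⟨ c-cong (suc i) (s≤s z≤n) i<n Ty≈-y ⟩
        c (suc i) (-ᴹ y)     ≈⟨ c--ᴹ (s≤s z≤n) i<n y ⟩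
        -ᴹ c (suc i) y       ∎

      Tcᵢ₊₁-des : T i (c (suc i) y) ≈ᴹ -ᴹ c (suc i) y
      Tcᵢ₊₁-des = begin
        T i (c (suc i) y)                    ≈⟨ T-cᵢ₊₁ y ⟩
        c i (T i y +ᴹ y) +ᴹ -ᴹ c (suc i) y   ≈⟨ +ᴹ-congʳ (c-cong i 1≤i i≤n (+ᴹ-congʳ Ty≈-y)) ⟩
        c i (-ᴹ y +ᴹ y) +ᴹ -ᴹ c (suc i) y    ≈⟨ +ᴹ-congʳ (c-cong i 1≤i i≤n (-ᴹ‿inverseˡ y)) ⟩
        c i 0ᴹ +ᴹ -ᴹ c (suc i) y             ≈⟨ +ᴹ-congʳ (c-0ᴹ 1≤i i≤n) ⟩
        0ᴹ +ᴹ -ᴹ c (suc i) y                 ≈⟨ +ᴹ-identityˡ _ ⟩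
        -ᴹ c (suc i) y                       ∎

      Tcᵢcᵢ₊₁-des : T i (c i (c (suc i) y)) ≈ᴹ y
      Tcᵢcᵢ₊₁-des = begin
        T i (c i (c (suc i) y))        ≈⟨ Tc-i i _ 1≤i i<n ⟩
        c (suc i) (T i (c (suc i) y))  ≈⟨ c-cong (suc i) (s≤s z≤n) i<n Tcᵢ₊₁-des ⟩
        c (suc i) (-ᴹ c (suc i) y)     ≈⟨ cᵢ₊₁[-cᵢ₊₁x]≈x y ⟩
        y                              ∎

    module _ {y : Carrierᴹ} (Ty≈0 : T i y ≈ᴹ 0ᴹ) where

      Tcᵢ-nondes : T i (c i y) ≈ᴹ 0ᴹ
      Tcᵢ-nondes = begin
        T i (c i y)          ≈⟨ Tc-i i y 1≤i i<n ⟩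
        c (suc i) (T i y)    ≈⟨ c-cong (suc i) (s≤s z≤n) i<n Ty≈0 ⟩
        c (suc i) 0ᴹ         ≈⟨ c-0ᴹ (s≤s z≤n) i<n ⟩
        0ᴹ                   ∎

      Tcᵢ₊₁-nondes : T i (c (suc i) y) ≈ᴹ -ᴹ c (suc i) y +ᴹ c i y
      Tcᵢ₊₁-nondes = begin
        T i (c (suc i) y)                    ≈⟨ T-cᵢ₊₁ y ⟩
        c i (T i y +ᴹ y) +ᴹ -ᴹ c (suc i) y   ≈⟨ +ᴹ-congʳ (c-cong i 1≤i i≤n (+ᴹ-congʳ Ty≈0)) ⟩
        c i (0ᴹ +ᴹ y) +ᴹ -ᴹ c (suc i) y      ≈⟨ +ᴹ-congʳ (c-cong i 1≤i i≤n (+ᴹ-identityˡ y)) ⟩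
        c i y +ᴹ -ᴹ c (suc i) y              ≈⟨ +ᴹ-comm _ _ ⟩
        -ᴹ c (suc i) y +ᴹ c i y              ∎

      Tcᵢcᵢ₊₁-nondes : T i (c i (c (suc i) y)) ≈ᴹ -ᴹ c i (c (suc i) y) +ᴹ y
      Tcᵢcᵢ₊₁-nondes = begin
        T i (c i (c (suc i) y))                             ≈⟨ Tc-i i _ 1≤i i<n ⟩
        c (suc i) (T i (c (suc i) y))                       ≈⟨ c-cong (suc i) (s≤s z≤n) i<n Tcᵢ₊₁-nondes ⟩
        c (suc i) (-ᴹ c (suc i) y +ᴹ c i y)                 ≈⟨ c-+ (suc i) _ _ (s≤s z≤n) i<n ⟩
        c (suc i) (-ᴹ c (suc i) y) +ᴹ c (suc i) (c i y)     ≈⟨ +ᴹ-cong (cᵢ₊₁[-cᵢ₊₁x]≈x y)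
                                                                 (c-anti (suc i) i y (s≤s z≤n) i<n 1≤i i≤n (λ ())) ⟩
        y +ᴹ -ᴹ c i (c (suc i) y)                           ≈⟨ +ᴹ-comm _ _ ⟩
        -ᴹ c i (c (suc i) y) +ᴹ y                           ∎

    module Triangularity (P : Set) (ε : Carrierᴹ) where

      DescentAction : Set ℓm
      DescentAction = (P × T i ε ≈ᴹ -ᴹ ε) ⊎ (¬ P × T i ε ≈ᴹ 0ᴹ)

      Triangular : ℕ → ℕ → ∀ {k} → Subset k → Set (r ⊔ ℓr ⊔ ℓm)
      Triangular p j {k} D =
        Σ R λ α → (α ≈ 0# ⊎ α ≈ - 1#) × Σ (List (R × Subset k)) λ L →
          All (StepAt P p D ∘ proj₂) L ×
          T i (cs j D ε) ≈ᴹ α *ₗ cs j D ε +ᴹ linComb (λ D′ → cs j D′ ε) L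

      module _ {k} (D : Subset k) (fits : suc (suc i) + k ≤ suc n) where
        private
          y : Carrierᴹ
          y = cs (suc (suc i)) D ε

          Ty≈cs[Tε] : T i y ≈ᴹ cs (suc (suc i)) D (T i ε)
          Ty≈cs[Tε] = cs-T-comm (suc (suc i)) D fits ≤-refl ε

          Ty≈-y : T i ε ≈ᴹ -ᴹ ε → T i y ≈ᴹ -ᴹ y
          Ty≈-y Tε≈-ε = ≈ᴹ-trans Ty≈cs[Tε]
            (≈ᴹ-trans (cs-cong _ D (s≤s z≤n) fits Tε≈-ε) (cs--ᴹ _ D (s≤s z≤n) fits ε))

          Ty≈0 : T i ε ≈ᴹ 0ᴹ → T i y ≈ᴹ 0ᴹ
          Ty≈0 Tε≈0 = ≈ᴹ-trans Ty≈cs[Tε]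
            (≈ᴹ-trans (cs-cong _ D (s≤s z≤n) fits Tε≈0) (cs-0ᴹ _ D (s≤s z≤n) fits))

        triangular-base : DescentAction → ∀ b b′ → Triangular 1 i (b ∷ b′ ∷ D)
        triangular-base (inj₁ (des , Tε)) false false =
          - 1# , inj₂ ≈-refl , [] , [] , ≈ᴹ-trans (Ty≈-y Tε) (-x≈-1*x+0 _)
        triangular-base (inj₁ (des , Tε)) true false =
          0# , inj₁ ≈-refl , (- 1# , false ∷ true ∷ D) ∷ [] , stepC des ≡.refl ≡.refl ∷ [] ,
          ≈ᴹ-trans (Tcᵢ-des (Ty≈-y Tε)) (-z≈0*x+[-1*z+0] _ _)
        triangular-base (inj₁ (des , Tε)) false true =
          - 1# , inj₂ ≈-refl , [] , [] , ≈ᴹ-trans (Tcᵢ₊₁-des (Ty≈-y Tε)) (-x≈-1*x+0 _)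
        triangular-base (inj₁ (des , Tε)) true true =
          0# , inj₁ ≈-refl , (1# , false ∷ false ∷ D) ∷ [] , stepD des ≡.refl ≡.refl ∷ [] ,
          ≈ᴹ-trans (Tcᵢcᵢ₊₁-des (Ty≈-y Tε)) (z≈0*x+[1*z+0] _ _)
        triangular-base (inj₂ (¬des , Tε)) false false =
          0# , inj₁ ≈-refl , [] , [] , ≈ᴹ-trans (Ty≈0 Tε) (0≈0*x+0 _)
        triangular-base (inj₂ (¬des , Tε)) true false =
          0# , inj₁ ≈-refl , [] , [] , ≈ᴹ-trans (Tcᵢ-nondes (Ty≈0 Tε)) (0≈0*x+0 _)
        triangular-base (inj₂ (¬des , Tε)) false true =
          - 1# , inj₂ ≈-refl , (1# , true ∷ false ∷ D) ∷ [] , stepA ¬des ≡.refl ≡.refl ∷ [] ,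
          ≈ᴹ-trans (Tcᵢ₊₁-nondes (Ty≈0 Tε)) (-x+z≈-1*x+[1*z+0] _ _)
        triangular-base (inj₂ (¬des , Tε)) true true =
          - 1# , inj₂ ≈-refl , (1# , false ∷ false ∷ D) ∷ [] , stepB ¬des ≡.refl ≡.refl ∷ [] ,
          ≈ᴹ-trans (Tcᵢcᵢ₊₁-nondes (Ty≈0 Tε)) (-x+z≈-1*x+[1*z+0] _ _)

      triangular-∷ : ∀ {k} j p b (D : Subset k) → 1 ≤ j → j < i → j + suc k ≤ suc n →
                     Triangular (suc p) (suc j) D → Triangular (suc (suc p)) j (b ∷ D)
      triangular-∷ j p false D _ _ _ (α , α∈ , L , steps , T≈) =
        α , α∈ , map (map₂ (false ∷_)) L , map⁺ (All.map (StepAt-∷ false) steps) ,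
        ≈ᴹ-trans T≈ (≈ᴹ-reflexive (≡.cong (α *ₗ cs (suc j) D ε +ᴹ_) (≡.sym (linComb-map₂ _ _ L))))
      triangular-∷ j p true D 1≤j j<i fits (α , α∈ , L , steps , T≈) =
        α , α∈ , map (map₂ (true ∷_)) L , map⁺ (All.map (StepAt-∷ true) steps) , (begin
          T i (c j x)                               ≈⟨ T-c-comm-< 1≤j j<i x ⟩
          c j (T i x)                               ≈⟨ c-cong j 1≤j j≤n T≈ ⟩
          c j (α *ₗ x +ᴹ linComb g L)               ≈⟨ c-+ j _ _ 1≤j j≤n ⟩
          c j (α *ₗ x) +ᴹ c j (linComb g L)         ≈⟨ +ᴹ-cong (c-* j α x 1≤j j≤n) (c-linComb 1≤j j≤n g L) ⟩
          α *ₗ c j x +ᴹ linComb (c j ∘ g) L         ≡⟨ ≡.cong (α *ₗ c j x +ᴹ_) (linComb-map₂ _ _ L) ⟨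
          α *ₗ c j x +ᴹ linComb (λ D′ → cs j D′ ε) (map (map₂ (true ∷_)) L) ∎)
        where
        x : Carrierᴹ
        x = cs (suc j) D ε
        g : Subset _ → Carrierᴹ
        g D′ = cs (suc j) D′ ε
        j≤n : j ≤ n
        j≤n = m+[1+k]≤1+n⇒m≤n fits

      -- D occupies the indices j, j+1, …, so its entry suc p is the global index p + j = i.
      triangular : DescentAction → ∀ {k} j p (D : Subset k) → 1 ≤ j → j + k ≤ suc n →
                   suc (suc p) ≤ k → i ≡ p + j → Triangular (suc p) j D
      triangular act j zero (b ∷ b′ ∷ D) _ fits _ ≡.refl =
        triangular-base D (m+[1+k]≤n⇒1+m+k≤n {suc i} (m+[1+k]≤n⇒1+m+k≤n {i} fits)) act b b′
      triangular act j zero (b ∷ []) _ _ (s≤s ()) _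
      triangular act j (suc p) (b ∷ D) 1≤j fits (s≤s p<k) i≡ =
        triangular-∷ j p b D 1≤j j<i fits
          (triangular act (suc j) p D (s≤s z≤n) (m+[1+k]≤n⇒1+m+k≤n fits) p<k
            (≡.trans i≡ (≡.sym (+-suc p j))))
        where
        j<i : j < i
        j<i = ≡.subst (j <_) (≡.sym i≡) (s≤s (m≤n+m j p))

mainTheorem2 : {r ℓr m ℓm : Level} (K : CommutativeRing r ℓr) (M : Module K m ℓm)
    (n : ℕ) (H : HClModule M n) (I : Composition n) (ε : Module.Carrierᴹ M) →
    IsGeneratorOfS M H I ε → IsCBasis M H ε →
    ∀ (i : ℕ) → 1 ≤ i → suc i ≤ n → ∀ (D : Subset n) →
    Σ (CommutativeRing.Carrier K) λ α →
      (CommutativeRing._≈_ K α (CommutativeRing.0# K)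
        ⊎ CommutativeRing._≈_ K α (CommutativeRing.-_ K (CommutativeRing.1# K)))
      × Σ (List (CommutativeRing.Carrier K × Subset n)) λ L →
          All (λ p → proj₂ p <[ I ] D) L
          × Module._≈ᴹ_ M (HClModule.T H i (cD M H D ε))
              (Module._+ᴹ_ M (Module._*ₗ_ M α (cD M H D ε)) (sumList M H L ε))
mainTheorem2 K M n H I ε isGen _ (suc i) 1≤i@(s≤s z≤n) i<n D =
  let (α , α∈ , L , steps , T≈) = result
  in α , α∈ , L , All.map (StepAt⇒< I (suc i) 1≤i i<n) steps , T≈
  where
  open HClFacts.AtIndex H (suc i) 1≤i i<n
  open Triangularity (suc i ∈ Des I) ε
  open IsGeneratorOfS isGen

  descent : DescentAction
  descent with suc i ∈? Des I
  ... | yes des = inj₁ (des , T-des (suc i) 1≤i i<n des)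
  ... | no ¬des = inj₂ (¬des , T-nondes (suc i) 1≤i i<n ¬des)

  result : Triangular (suc i) 1 D
  result = triangular descent 1 i D ≤-refl ≤-refl i<n (+-comm 1 i)
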